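{- Let $\mathbf{D}$ be a D-core algebra and $x,y,z\in D$. Then: (1a) $\bot\sqcap\neg(\neg x\sqcap\lrcorner y)=\bot\sqcap x$, (1b) $\top\sqcup\lrcorner(\lrcorner x\sqcup\neg y)=\top\sqcup x$; (2a) $x\sqcap\neg(\neg x\sqcap\neg y)=x\sqcap\neg(\neg y\sqcap\neg\top)$, (2b) $x\sqcup\lrcorner(\lrcorner x\sqcup\lrcorner y)=x\sqcup\lrcorner(\lrcorner y\sqcup\lrcorner\bot)$; (3a) $x\sqcap\neg(\neg y\sqcap\neg(x\sqcup z))=x\sqcap\neg(\bot\sqcap\neg y)$, (3b) $x\sqcup\lrcorner(\lrcorner y\sqcup\lrcorner(x\sqcap z))=x\sqcup\lrcorner(\top\sqcup\lrcorner y)$; (4a) $\bot\sqcap x=\bot$, (4b) $\top\sqcup x=\top$.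
   Context: Write $x\vee y:=\neg(\neg x\sqcap\neg y)$ and $x\wedge y:=\lrcorner(\lrcorner x\sqcup\lrcorner y)$. A D-core algebra is an algebra $(D;\sqcap,\sqcup,\neg,\lrcorner,\top,\bot)$ of type $(2,2,1,1,0,0)$ satisfying, for all $x,y,z\in D$: $x\sqcap y=y\sqcap x$; $x\sqcup y=y\sqcup x$; $\neg(x\sqcap x)=\neg x$; $\lrcorner(x\sqcup x)=\lrcorner x$; $x\sqcap(x\sqcup y)=x\sqcap x$; $x\sqcup(x\sqcap y)=x\sqcup x$; $x\sqcap(y\vee z)=(x\sqcap y)\vee(x\sqcap z)$; $x\sqcup(y\wedge z)=(x\sqcup y)\wedge(x\sqcup z)$; $\neg\neg(x\sqcap y)=x\sqcap y$; $\lrcorner\lrcorner(x\sqcup y)=x\sqcup y$; $x\sqcap\neg x=\bot$; $x\sqcup\lrcorner x=\top$; $(x\sqcap x)\sqcup(x\sqcap x)=(x\sqcup x)\sqcap(x\sqcup x)$. -}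

module Defs where

open import Level using (Level; suc)
open import Relation.Binary.PropositionalEquality using (_≡_)

record DCoreAlgebra (a : Level) : Set (suc a) where
  infixr 7 _⊓_
  infixr 6 _⊔_
  field
    Carrier : Set a
    _⊓_ _⊔_ : Carrier → Carrier → Carrier
    ¬_ ⌟_   : Carrier → Carrier
    ⊤ ⊥     : Carrier

  _∨_ : Carrier → Carrier → Carrier
  x ∨ y = ¬ ((¬ x) ⊓ (¬ y))

  _∧_ : Carrier → Carrier → Carrier
  x ∧ y = ⌟ ((⌟ x) ⊔ (⌟ y))

  field
    ⊓-comm    : ∀ x y → x ⊓ y ≡ y ⊓ x
    ⊔-comm    : ∀ x y → x ⊔ y ≡ y ⊔ x
    ¬-⊓-idem  : ∀ x → ¬ (x ⊓ x) ≡ ¬ x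
    ⌟-⊔-idem  : ∀ x → ⌟ (x ⊔ x) ≡ ⌟ x
    ⊓-absorb  : ∀ x y → x ⊓ (x ⊔ y) ≡ x ⊓ x
    ⊔-absorb  : ∀ x y → x ⊔ (x ⊓ y) ≡ x ⊔ x
    ⊓-distrib : ∀ x y z → x ⊓ (y ∨ z) ≡ (x ⊓ y) ∨ (x ⊓ z)
    ⊔-distrib : ∀ x y z → x ⊔ (y ∧ z) ≡ (x ⊔ y) ∧ (x ⊔ z)
    ¬¬-⊓      : ∀ x y → ¬ (¬ (x ⊓ y)) ≡ x ⊓ y
    ⌟⌟-⊔      : ∀ x y → ⌟ (⌟ (x ⊔ y)) ≡ x ⊔ y
    ⊓-¬       : ∀ x → x ⊓ (¬ x) ≡ ⊥
    ⊔-⌟       : ∀ x → x ⊔ (⌟ x) ≡ ⊤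
    ⊓⊔-swap   : ∀ x → (x ⊓ x) ⊔ (x ⊓ x) ≡ (x ⊔ x) ⊓ (x ⊔ x)

{-# OPTIONS --safe #-}
module Submission where

open import Defs
open import Level using (Level)
open import Data.Product using (_×_; _,_)
open import Relation.Binary.PropositionalEquality using (_≡_; sym; trans; cong)
open Relation.Binary.PropositionalEquality.≡-Reasoning

-- The axioms are invariant under ⊓ ↔ ⊔, ¬ ↔ ⌟, ⊤ ↔ ⊥, so every (b) part is the
-- (a) part read in the dual algebra. For the (a) parts, distributivity makes
-- x ⊓ (y ∨ w) depend on w only through x ⊓ w; since x ⊓ x = x ⊓ ⊤ = x ⊓ (x ⊔ z),
-- the disjunct can be replaced by ⊤, and ¬ ⊤ = ⊥. The same trick with
-- x ⊓ ⊥ = (x ⊓ ⊥) ∨ (x ⊓ ¬ x) shows that ⊥ is absorbing.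

dual : ∀ {a : Level} → DCoreAlgebra a → DCoreAlgebra a
dual D = record
  { Carrier = Carrier
  ; _⊓_ = _⊔_ ; _⊔_ = _⊓_ ; ¬_ = ⌟_ ; ⌟_ = ¬_ ; ⊤ = ⊥ ; ⊥ = ⊤
  ; ⊓-comm = ⊔-comm ; ⊔-comm = ⊓-comm
  ; ¬-⊓-idem = ⌟-⊔-idem ; ⌟-⊔-idem = ¬-⊓-idem
  ; ⊓-absorb = ⊔-absorb ; ⊔-absorb = ⊓-absorb
  ; ⊓-distrib = ⊔-distrib ; ⊔-distrib = ⊓-distrib
  ; ¬¬-⊓ = ⌟⌟-⊔ ; ⌟⌟-⊔ = ¬¬-⊓
  ; ⊓-¬ = ⊔-⌟ ; ⊔-⌟ = ⊓-¬
  ; ⊓⊔-swap = λ x → sym (⊓⊔-swap x)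
  }
  where open DCoreAlgebra D

module MeetProperties {a : Level} (D : DCoreAlgebra a) where
  open DCoreAlgebra D

  ⊓-self≡¬¬ : ∀ x → x ⊓ x ≡ ¬ ¬ x
  ⊓-self≡¬¬ x = trans (sym (¬¬-⊓ x x)) (cong ¬_ (¬-⊓-idem x))

  ¬¬¬≡¬ : ∀ x → ¬ ¬ ¬ x ≡ ¬ x
  ¬¬¬≡¬ x = trans (cong ¬_ (sym (⊓-self≡¬¬ x))) (¬-⊓-idem x)

  ∨-self≡¬¬ : ∀ x → x ∨ x ≡ ¬ ¬ x
  ∨-self≡¬¬ x = ¬-⊓-idem (¬ x)

  ∨-comm : ∀ x y → x ∨ y ≡ y ∨ x
  ∨-comm x y = cong ¬_ (⊓-comm (¬ x) (¬ y))

  ⊓-¬¬ʳ : ∀ x y → x ⊓ ¬ ¬ y ≡ x ⊓ y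
  ⊓-¬¬ʳ x y = begin
    x ⊓ ¬ ¬ y           ≡⟨ cong (x ⊓_) (∨-self≡¬¬ y) ⟨
    x ⊓ (y ∨ y)         ≡⟨ ⊓-distrib x y y ⟩
    (x ⊓ y) ∨ (x ⊓ y)   ≡⟨ ∨-self≡¬¬ (x ⊓ y) ⟩
    ¬ ¬ (x ⊓ y)         ≡⟨ ¬¬-⊓ x y ⟩
    x ⊓ y               ∎

  ⊓-⊤ʳ : ∀ x → x ⊓ ⊤ ≡ x ⊓ x
  ⊓-⊤ʳ x = trans (cong (x ⊓_) (sym (⊔-⌟ x))) (⊓-absorb x (⌟ x))

  ¬⊤≡⊥ : ¬ ⊤ ≡ ⊥
  ¬⊤≡⊥ = begin
    ¬ ⊤             ≡⟨ ¬¬¬≡¬ ⊤ ⟨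
    ¬ ¬ ¬ ⊤         ≡⟨ ⊓-self≡¬¬ (¬ ⊤) ⟨
    ¬ ⊤ ⊓ ¬ ⊤       ≡⟨ ⊓-⊤ʳ (¬ ⊤) ⟨
    ¬ ⊤ ⊓ ⊤         ≡⟨ ⊓-¬¬ʳ (¬ ⊤) ⊤ ⟨
    ¬ ⊤ ⊓ ¬ ¬ ⊤     ≡⟨ ⊓-¬ (¬ ⊤) ⟩
    ⊥               ∎

  ⊓-¬⊥ʳ : ∀ x → x ⊓ ¬ ⊥ ≡ ¬ ¬ x
  ⊓-¬⊥ʳ x = begin
    x ⊓ ¬ ⊥         ≡⟨ cong (λ t → x ⊓ ¬ t) ¬⊤≡⊥ ⟨
    x ⊓ ¬ ¬ ⊤       ≡⟨ ⊓-¬¬ʳ x ⊤ ⟩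
    x ⊓ ⊤           ≡⟨ ⊓-⊤ʳ x ⟩
    x ⊓ x           ≡⟨ ⊓-self≡¬¬ x ⟩
    ¬ ¬ x           ∎

  ∨-⊥ʳ : ∀ x → x ∨ ⊥ ≡ ¬ ¬ x
  ∨-⊥ʳ x = cong ¬_ (trans (⊓-¬⊥ʳ (¬ x)) (¬¬¬≡¬ x))

  ⊓-∨-congʳ : ∀ x y {w w′} → x ⊓ w ≡ x ⊓ w′ → x ⊓ (y ∨ w) ≡ x ⊓ (y ∨ w′)
  ⊓-∨-congʳ x y {w} {w′} eq = begin
    x ⊓ (y ∨ w)          ≡⟨ ⊓-distrib x y w ⟩
    (x ⊓ y) ∨ (x ⊓ w)    ≡⟨ cong ((x ⊓ y) ∨_) eq ⟩
    (x ⊓ y) ∨ (x ⊓ w′)   ≡⟨ ⊓-distrib x y w′ ⟨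
    x ⊓ (y ∨ w′)         ∎

  ⊓-zeroʳ : ∀ x → x ⊓ ⊥ ≡ ⊥
  ⊓-zeroʳ x = begin
    x ⊓ ⊥                  ≡⟨ ¬¬-⊓ x ⊥ ⟨
    ¬ ¬ (x ⊓ ⊥)            ≡⟨ ∨-⊥ʳ (x ⊓ ⊥) ⟨
    (x ⊓ ⊥) ∨ ⊥            ≡⟨ cong ((x ⊓ ⊥) ∨_) (⊓-¬ x) ⟨
    (x ⊓ ⊥) ∨ (x ⊓ ¬ x)    ≡⟨ ⊓-distrib x ⊥ (¬ x) ⟨
    x ⊓ (⊥ ∨ (¬ x))        ≡⟨ cong (x ⊓_) (∨-comm ⊥ (¬ x)) ⟩
    x ⊓ ((¬ x) ∨ ⊥)        ≡⟨ cong (x ⊓_) (∨-⊥ʳ (¬ x)) ⟩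
    x ⊓ ¬ ¬ ¬ x            ≡⟨ cong (x ⊓_) (¬¬¬≡¬ x) ⟩
    x ⊓ ¬ x                ≡⟨ ⊓-¬ x ⟩
    ⊥                      ∎

  ⊓-zeroˡ : ∀ x → ⊥ ⊓ x ≡ ⊥
  ⊓-zeroˡ x = trans (⊓-comm ⊥ x) (⊓-zeroʳ x)

  ⊥⊓-const : ∀ x y → ⊥ ⊓ y ≡ ⊥ ⊓ x
  ⊥⊓-const x y = trans (⊓-zeroˡ y) (sym (⊓-zeroˡ x))

  x⊓[x∨y]≡x⊓[y∨⊤] : ∀ x y → x ⊓ (x ∨ y) ≡ x ⊓ (y ∨ ⊤)
  x⊓[x∨y]≡x⊓[y∨⊤] x y = begin
    x ⊓ (x ∨ y)   ≡⟨ cong (x ⊓_) (∨-comm x y) ⟩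
    x ⊓ (y ∨ x)   ≡⟨ ⊓-∨-congʳ x y (sym (⊓-⊤ʳ x)) ⟩
    x ⊓ (y ∨ ⊤)   ∎

  x⊓[y∨[x⊔z]]≡x⊓¬[⊥⊓¬y] : ∀ x y z → x ⊓ (y ∨ (x ⊔ z)) ≡ x ⊓ ¬ (⊥ ⊓ ¬ y)
  x⊓[y∨[x⊔z]]≡x⊓¬[⊥⊓¬y] x y z = begin
    x ⊓ (y ∨ (x ⊔ z))   ≡⟨ ⊓-∨-congʳ x y (trans (⊓-absorb x z) (sym (⊓-⊤ʳ x))) ⟩
    x ⊓ (y ∨ ⊤)         ≡⟨ cong (x ⊓_) (∨-comm y ⊤) ⟩
    x ⊓ ¬ (¬ ⊤ ⊓ ¬ y)   ≡⟨ cong (λ t → x ⊓ ¬ (t ⊓ ¬ y)) ¬⊤≡⊥ ⟩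
    x ⊓ ¬ (⊥ ⊓ ¬ y)     ∎

proposition3p7 : ∀ {a : Level} (D : DCoreAlgebra a) → let open DCoreAlgebra D in
    ∀ x y z →
      ((⊥ ⊓ (¬ ((¬ x) ⊓ (⌟ y)))) ≡ (⊥ ⊓ x))
    × ((⊤ ⊔ (⌟ ((⌟ x) ⊔ (¬ y)))) ≡ (⊤ ⊔ x))
    × ((x ⊓ (¬ ((¬ x) ⊓ (¬ y)))) ≡ (x ⊓ (¬ ((¬ y) ⊓ (¬ ⊤)))))
    × ((x ⊔ (⌟ ((⌟ x) ⊔ (⌟ y)))) ≡ (x ⊔ (⌟ ((⌟ y) ⊔ (⌟ ⊥)))))
    × ((x ⊓ (¬ ((¬ y) ⊓ (¬ (x ⊔ z))))) ≡ (x ⊓ (¬ (⊥ ⊓ (¬ y)))))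
    × ((x ⊔ (⌟ ((⌟ y) ⊔ (⌟ (x ⊓ z))))) ≡ (x ⊔ (⌟ (⊤ ⊔ (⌟ y)))))
    × ((⊥ ⊓ x) ≡ ⊥)
    × ((⊤ ⊔ x) ≡ ⊤)
proposition3p7 D x y z =
    M.⊥⊓-const x _ , J.⊥⊓-const x _
  , M.x⊓[x∨y]≡x⊓[y∨⊤] x y , J.x⊓[x∨y]≡x⊓[y∨⊤] x y
  , M.x⊓[y∨[x⊔z]]≡x⊓¬[⊥⊓¬y] x y z , J.x⊓[y∨[x⊔z]]≡x⊓¬[⊥⊓¬y] x y z
  , M.⊓-zeroˡ x , J.⊓-zeroˡ x
  where
    module M = MeetProperties D
    module J = MeetProperties (dual D)
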